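{- Let $\mathbf{A}\subset\mathbb{R}^n$ be a finite point configuration affinely spanning $\mathbb{R}^n$, let $R$ be an $\mathbf{A}$-ridge graph and let $r_1,r_2\in R$. Among the four cones \[F_{\sigma_1\sigma_2}:=\{\sigma_1\ell_\bullet(r_1)\geq 0\}\cap\{\sigma_2\ell_\bullet(r_2)\geq 0\}\cap\{\sigma_2\ell_\bullet(r_2)-\sigma_1\ell_\bullet(r_1)\geq 0\}\subset\mathbb{R}^{\mathbf{A}},\qquad \sigma_1,\sigma_2\in\{+,-\},\] of the fan $F^{(\ell_\bullet(r_1),\ell_\bullet(r_2))}=\{g\colon|\ell_g(r_1)|\leq|\ell_g(r_2)|\}$, at most one cone $c$ satisfies $\dim(c\cap\operatorname{sc}(R))=\#\mathbf{A}$.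
   Context: An $\mathbf{A}$-ridge is a pair $r=(s,t)$ of full-dimensional simplices $s=\operatorname{conv}(v_1,\ldots,v_{n+1})$, $t=\operatorname{conv}(v_2,\ldots,v_{n+2})$ with $v_i\in\mathbf{A}$ sharing the facet $\operatorname{conv}(v_2,\ldots,v_{n+1})$. Its edge length linear form $\ell_\bullet(r)\colon\mathbb{R}^{\mathbf{A}}\to\mathbb{R}$ is $g\mapsto\ell_g(r):=\det M_g(r)$, with $M_g(r)$ the $(n+2)\times(n+2)$ matrix with rows $(1,v_{i,1},\ldots,v_{i,n},g(v_i))$, $i=1,\ldots,n+2$. For $h\in\mathbb{R}^{\mathbf{A}}$, $\Sigma(h)$ denotes the regular subdivision of $\mathbf{A}$ induced by the upper hull of $\{(v,h(v))\}$ and $\Gamma(h)$ its dual graph (maximal cells as nodes, adjacent along a facet as edges). An $\mathbf{A}$-ridge graph is a finite set $R$ of $\mathbf{A}$-ridges with $R\subset\Gamma(h)$ for some regular subdivision $\Sigma(h)$. For a full-dimensional simplex $s$ with vertices in $\mathbf{A}$, $H_s$ is the set of $g\in\mathbb{R}^{\mathbf{A}}$ such that all $(v,g(v))$, $v\in\mathbf{A}$, lie on or below the affine hyperplane through the lifted vertices $(w,g(w))$ of $s$; and $\operatorname{sc}(R):=\bigcap_{s\in V(R)}H_s$, $V(R)$ being the simplices occurring in ridges of $R$. -}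

module Defs where

open import Level using (0ℓ)
open import Data.Nat using (ℕ; zero; suc)
open import Data.Fin using (Fin; zero; suc; punchIn; inject₁; fromℕ)
open import Data.Product using (Σ; ∃; ∃-syntax; _×_; _,_)
open import Data.List using (List)
open import Data.List.Relation.Unary.All using (All)
open import Relation.Binary.PropositionalEquality using (_≡_)
open import Relation.Nullary using (¬_)
open import Algebra.Structures using (IsCommutativeRing)
open import Relation.Binary.Structures using (IsTotalOrder)

-- An axiomatisation of the real numbers: a complete (Dedekind / least
-- upper bound) totally ordered field, with propositional equality.

record RealField : Set₁ where
  infixl 6 _+_
  infixl 7 _*_
  infix  4 _≤_
  field
    Carrier : Set
    _+_ _*_ : Carrier → Carrier → Carrier
    -_      : Carrier → Carrier
    0# 1#   : Carrier
    isCommutativeRing : IsCommutativeRing _≡_ _+_ _*_ -_ 0# 1#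
    0≢1     : ¬ (0# ≡ 1#)
    inverse : ∀ x → ¬ (x ≡ 0#) → ∃[ y ] (x * y ≡ 1#)
    _≤_     : Carrier → Carrier → Set
    isTotalOrder : IsTotalOrder _≡_ _≤_
    +-mono-≤ : ∀ {x y} z → x ≤ y → x + z ≤ y + z
    *-nonneg : ∀ {x y} → 0# ≤ x → 0# ≤ y → 0# ≤ x * y
    lub : (P : Carrier → Set) → ∃ P → (∃[ b ] (∀ x → P x → x ≤ b)) →
          ∃[ s ] ((∀ x → P x → x ≤ s) × (∀ u → (∀ x → P x → x ≤ u) → s ≤ u))

module WithReals (ℝ : RealField) where
  open RealField ℝ

  _-_ : Carrier → Carrier → Carrier
  x - y = x + (- y)

  sumFin : ∀ {k} → (Fin k → Carrier) → Carrier
  sumFin {zero}  f = 0#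
  sumFin {suc k} f = f zero + sumFin (λ i → f (suc i))

  altSign : ℕ → Carrier → Carrier
  altSign zero    x = x
  altSign (suc k) x = - altSign k x

  toℕ' : ∀ {k} → Fin k → ℕ
  toℕ' zero    = zero
  toℕ' (suc i) = suc (toℕ' i)

  det : ∀ k → (Fin k → Fin k → Carrier) → Carrier
  det zero    M = 1#
  det (suc k) M =
    sumFin (λ j → altSign (toℕ' j) (M zero j * det k (λ a b → M (suc a) (punchIn j b))))

  snoc : ∀ n → (Fin n → Carrier) → Carrier → Fin (suc n) → Carrier
  snoc zero    f c zero    = c
  snoc (suc n) f c zero    = f zero
  snoc (suc n) f c (suc i) = snoc n (λ j → f (suc j)) c i

  liftedRow : ∀ {n} → (Fin n → Carrier) → Carrier → Fin (suc (suc n)) → Carrier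
  liftedRow {n} x c zero    = 1#
  liftedRow {n} x c (suc i) = snoc n x c i

  AffinelyIndependent : ∀ {k d} → (Fin k → Fin d → Carrier) → Set
  AffinelyIndependent {k} p =
    ∀ (λ' : Fin k → Carrier) → sumFin λ' ≡ 0# →
      (∀ j → sumFin (λ i → λ' i * p i j) ≡ 0#) → ∀ i → λ' i ≡ 0#

  AffinelySpanning : ∀ {m n} → (Fin m → Fin n → Carrier) → Set
  AffinelySpanning {m} {n} A =
    ∀ (x : Fin n → Carrier) → ∃[ λ' ] ((sumFin λ' ≡ 1#) × (∀ j → sumFin (λ i → λ' i * A i j) ≡ x j))

  evalAff : ∀ {n} → Carrier × (Fin n → Carrier) → (Fin n → Carrier) → Carrier
  evalAff (c₀ , c) x = c₀ + sumFin (λ j → c j * x j)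

  -- A simplex with vertices in A, given by the indices of its n+1 vertices
  Simplex : ℕ → ℕ → Set
  Simplex m n = Fin (suc n) → Fin m

  FullDimSimplex : ∀ {m n} → (Fin m → Fin n → Carrier) → Simplex m n → Set
  FullDimSimplex A w = AffinelyIndependent (λ i → A (w i))

  -- g ∈ H_s : all lifted points (a, g a) lie on or below the (non-vertical)
  -- affine hyperplane through the lifted vertices of s
  InH : ∀ {m n} → (Fin m → Fin n → Carrier) → Simplex m n → (Fin m → Carrier) → Set
  InH A w g = ∃[ φ ] ((∀ i → evalAff φ (A (w i)) ≡ g (w i)) × (∀ a → g a ≤ evalAff φ (A a)))

  -- s is a maximal cell of the regular subdivision Σ(h) (upper hull):
  -- the hyperplane through the lifted vertices of s supports the lifted
  -- configuration from above and contains exactly the lifted vertices of s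
  IsMaxCell : ∀ {m n} → (Fin m → Fin n → Carrier) → (Fin m → Carrier) → Simplex m n → Set
  IsMaxCell A h w =
    FullDimSimplex A w ×
    ∃[ φ ] ((∀ i → evalAff φ (A (w i)) ≡ h (w i)) × (∀ a → h a ≤ evalAff φ (A a)) ×
            (∀ a → h a ≡ evalAff φ (A a) → ∃[ i ] (w i ≡ a)))

  -- A-ridges: vertex index tuples (v₁,…,v_{n+2});
  -- s = conv(v₁,…,v_{n+1}), t = conv(v₂,…,v_{n+2})
  RidgeData : ℕ → ℕ → Set
  RidgeData m n = Fin (suc (suc n)) → Fin m

  sOf : ∀ {m n} → RidgeData m n → Simplex m n
  sOf r i = r (inject₁ i)

  tOf : ∀ {m n} → RidgeData m n → Simplex m n
  tOf r i = r (suc i)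

  IsRidge : ∀ {m n} → (Fin m → Fin n → Carrier) → RidgeData m n → Set
  IsRidge {n = n} A r =
    FullDimSimplex A (sOf r) × FullDimSimplex A (tOf r) × ¬ (r zero ≡ r (fromℕ (suc n)))

  -- r is an edge of the dual graph Γ(h): s and t are maximal cells of Σ(h)
  -- (they are adjacent along their common facet by construction)
  InDualGraph : ∀ {m n} → (Fin m → Fin n → Carrier) → (Fin m → Carrier) → RidgeData m n → Set
  InDualGraph A h r = IsMaxCell A h (sOf r) × IsMaxCell A h (tOf r)

  IsRidgeGraph : ∀ {m n} → (Fin m → Fin n → Carrier) → List (RidgeData m n) → Set
  IsRidgeGraph A R = All (IsRidge A) R × ∃[ h ] All (InDualGraph A h) R

  -- sc(R) = ⋂_{s ∈ V(R)} H_s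
  InSc : ∀ {m n} → (Fin m → Fin n → Carrier) → List (RidgeData m n) → (Fin m → Carrier) → Set
  InSc A R g = All (λ r → InH A (sOf r) g × InH A (tOf r) g) R

  ℓ : ∀ {m n} → (Fin m → Fin n → Carrier) → RidgeData m n → (Fin m → Carrier) → Carrier
  ℓ {n = n} A r g = det (suc (suc n)) (λ i → liftedRow (A (r i)) (g (r i)))

  data Sign : Set where
    plus minus : Sign

  applySign : Sign → Carrier → Carrier
  applySign plus  x = x
  applySign minus x = - x

  InCone : ∀ {m n} → (Fin m → Fin n → Carrier) → RidgeData m n → RidgeData m n →
           Sign → Sign → (Fin m → Carrier) → Set
  InCone A r₁ r₂ σ₁ σ₂ g =
    (0# ≤ applySign σ₁ (ℓ A r₁ g)) × (0# ≤ applySign σ₂ (ℓ A r₂ g)) ×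
    (0# ≤ applySign σ₂ (ℓ A r₂ g) - applySign σ₁ (ℓ A r₁ g))

  -- dim S = m for S ⊆ ℝ^m (affine-hull dimension): S contains m+1
  -- affinely independent points
  HasFullDim : ∀ {m} → ((Fin m → Carrier) → Set) → Set
  HasFullDim {m} S = ∃[ p ] ((∀ (i : Fin (suc m)) → S (p i)) × AffinelyIndependent p)

open WithReals public

{-# OPTIONS --safe #-}
module Submission where

-- On H_s the edge length form factors as ℓ_g(r) = (g(v_{n+2}) - φ(v_{n+2})) · D, where φ is the affine
-- function interpolating g on the vertices of s and D ≠ 0 is the determinant of the vertices of s, each
-- extended by a leading 1. Points of H_s lie below φ, so on sc(R) ⊆ H_s the form ℓ_•(r) weakly has the
-- sign of -D. Two cones with different signs for r can therefore both meet sc(R) full-dimensionally only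
-- if ℓ_•(r) vanishes at #A + 1 affinely independent points. These span ℝ^A, so the linear form ℓ_•(r)
-- would vanish at the indicator function of v_{n+2}, where it equals D.

open import Level using (0ℓ)
open import Defs using (RealField; module WithReals)
open import Data.Nat as ℕ using (ℕ; zero; suc)
open import Data.Integer as ℤ using (ℤ; -[1+_])
import Data.Integer.Properties as ℤ
import Data.Nat.Properties as ℕ
import Data.Sign as Sign
open import Data.Fin as Fin using (Fin; zero; suc; punchIn; punchOut; inject₁; fromℕ)
import Data.Fin.Properties as Fin
open import Data.Product using (∃; _×_; _,_; proj₁; proj₂)
open import Data.Sum using (_⊎_; inj₁; inj₂)
open import Data.Maybe using (Maybe; just; nothing)
open import Relation.Binary.PropositionalEquality
open import Relation.Nullary using (¬_; yes; no; ¬¬-excluded-middle)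
open import Relation.Nullary.Negation using (¬¬-Monad)
open import Effect.Monad using (RawMonad)
open import Data.Empty using (⊥; ⊥-elim)
open import Function using (_∘_)
open import Data.Vec.Functional using (insertAt)
open import Data.Vec.Functional.Properties using (insertAt-lookup; insertAt-punchIn)
open import Algebra.Bundles using (CommutativeRing; RawRing)
open import Algebra.Solver.Ring.AlmostCommutativeRing
  using (fromCommutativeRing; _-Raw-AlmostCommutative⟶_)
import Algebra.Solver.Ring
import Algebra.Properties.Ring
import Algebra.Properties.Semiring.Mult
open import Relation.Binary.Structures using (IsTotalOrder)

module _ (ℝ : RealField) where
  open RealField ℝ
  open WithReals ℝ
  open ≡-Reasoning

  commutativeRing : CommutativeRing 0ℓ 0ℓ
  commutativeRing = record { isCommutativeRing = isCommutativeRing }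

  open CommutativeRing commutativeRing
    using (+-assoc; +-comm; *-assoc; *-comm; +-identityˡ; +-identityʳ;
           *-identityˡ; *-identityʳ; -‿inverseʳ; -‿inverseˡ; zeroˡ; zeroʳ; ring; semiring)
  open Algebra.Properties.Ring ring
    using (-‿involutive; -‿distribˡ-*; -‿distribʳ-*; -‿+-comm; -0#≈0#)
  open Algebra.Properties.Semiring.Mult semiring
    using (×-homo-+; ×1-homo-*) renaming (_×_ to _×ₙ_)

  -- _-_ from Defs has no fixity declaration, so it binds tighter than _+_ and _*_.
  x-0≡x : ∀ x → x - 0# ≡ x
  x-0≡x x = trans (cong (x +_) -0#≈0#) (+-identityʳ x)

  -- The ring solver needs coefficients whose equality it can decide: integers, mapped into ℝ by fromℤ.
  fromℤ : ℤ → Carrier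
  fromℤ (ℤ.+ n)    = n ×ₙ 1#
  fromℤ -[1+ n ] = - (suc n ×ₙ 1#)

  private
    1+a-[1+b]≡a-b : ∀ a b → (1# + a) - (1# + b) ≡ a - b
    1+a-[1+b]≡a-b a b = begin
      (1# + a) + - (1# + b)         ≡⟨ cong ((1# + a) +_) (sym (-‿+-comm 1# b)) ⟩
      (1# + a) + (- 1# + - b)       ≡⟨ +-assoc 1# a _ ⟩
      1# + (a + (- 1# + - b))       ≡⟨ cong (1# +_) (sym (+-assoc a _ _)) ⟩
      1# + ((a + - 1#) + - b)       ≡⟨ cong (λ x → 1# + (x + - b)) (+-comm a _) ⟩
      1# + ((- 1# + a) + - b)       ≡⟨ cong (1# +_) (+-assoc _ a _) ⟩
      1# + (- 1# + (a - b))         ≡⟨ sym (+-assoc 1# _ _) ⟩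
      (1# + - 1#) + (a - b)         ≡⟨ cong (_+ (a - b)) (-‿inverseʳ 1#) ⟩
      0# + (a - b)                  ≡⟨ +-identityˡ _ ⟩
      a - b                         ∎

  fromℤ-⊖ : ∀ m n → fromℤ (m ℤ.⊖ n) ≡ (m ×ₙ 1#) - (n ×ₙ 1#)
  fromℤ-⊖ zero    zero    = sym (x-0≡x 0#)
  fromℤ-⊖ (suc m) zero    = sym (x-0≡x _)
  fromℤ-⊖ zero    (suc n) = sym (+-identityˡ _)
  fromℤ-⊖ (suc m) (suc n) = begin
    fromℤ (suc m ℤ.⊖ suc n)        ≡⟨ cong fromℤ (ℤ.[1+m]⊖[1+n]≡m⊖n m n) ⟩
    fromℤ (m ℤ.⊖ n)                ≡⟨ fromℤ-⊖ m n ⟩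
    (m ×ₙ 1#) - (n ×ₙ 1#)              ≡⟨ sym (1+a-[1+b]≡a-b _ _) ⟩
    (suc m ×ₙ 1#) - (suc n ×ₙ 1#)      ∎

  fromℤ-+ : ∀ i j → fromℤ (i ℤ.+ j) ≡ fromℤ i + fromℤ j
  fromℤ-+ (ℤ.+ m)    (ℤ.+ n)    = ×-homo-+ 1# m n
  fromℤ-+ (ℤ.+ m)    -[1+ n ] = fromℤ-⊖ m (suc n)
  fromℤ-+ -[1+ m ] (ℤ.+ n)    = trans (fromℤ-⊖ n (suc m)) (+-comm _ _)
  fromℤ-+ -[1+ m ] -[1+ n ] = begin
    - (1# + suc (m ℕ.+ n) ×ₙ 1#)          ≡⟨ cong (λ x → - (1# + x)) (×-homo-+ 1# (suc m) n) ⟩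
    - (1# + (suc m ×ₙ 1# + n ×ₙ 1#))      ≡⟨ cong -_ (sym (+-assoc 1# _ _)) ⟩
    - ((1# + suc m ×ₙ 1#) + n ×ₙ 1#)      ≡⟨ cong (λ x → - (x + n ×ₙ 1#)) (+-comm 1# _) ⟩
    - ((suc m ×ₙ 1# + 1#) + n ×ₙ 1#)      ≡⟨ cong -_ (+-assoc _ 1# _) ⟩
    - (suc m ×ₙ 1# + suc n ×ₙ 1#)         ≡⟨ sym (-‿+-comm _ _) ⟩
    - (suc m ×ₙ 1#) + - (suc n ×ₙ 1#)     ∎

  fromℤ-neg : ∀ i → fromℤ (ℤ.- i) ≡ - fromℤ i
  fromℤ-neg (ℤ.+ zero)  = sym -0#≈0#
  fromℤ-neg (ℤ.+ suc n) = refl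
  fromℤ-neg -[1+ n ]  = sym (-‿involutive _)

  private
    signed : Sign.Sign → Carrier → Carrier
    signed Sign.+ x = x
    signed Sign.- x = - x

    fromℤ-◃ : ∀ s n → fromℤ (s ℤ.◃ n) ≡ signed s (n ×ₙ 1#)
    fromℤ-◃ Sign.+ zero    = refl
    fromℤ-◃ Sign.- zero    = sym -0#≈0#
    fromℤ-◃ Sign.+ (suc n) = refl
    fromℤ-◃ Sign.- (suc n) = refl

    fromℤ-sign-abs : ∀ i → fromℤ i ≡ signed (ℤ.sign i) (ℤ.∣ i ∣ ×ₙ 1#)
    fromℤ-sign-abs (ℤ.+ n)    = refl
    fromℤ-sign-abs -[1+ n ] = refl

    signed-* : ∀ s t x y → signed (s Sign.* t) (x * y) ≡ signed s x * signed t y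
    signed-* Sign.+ Sign.+ x y = refl
    signed-* Sign.+ Sign.- x y = -‿distribʳ-* x y
    signed-* Sign.- Sign.+ x y = -‿distribˡ-* x y
    signed-* Sign.- Sign.- x y = begin
      x * y           ≡⟨ sym (-‿involutive _) ⟩
      - - (x * y)     ≡⟨ cong -_ (-‿distribʳ-* x y) ⟩
      - (x * - y)     ≡⟨ -‿distribˡ-* x (- y) ⟩
      - x * - y       ∎

  fromℤ-* : ∀ i j → fromℤ (i ℤ.* j) ≡ fromℤ i * fromℤ j
  fromℤ-* i j = begin
    fromℤ (s ℤ.◃ ∣i∣ ℕ.* ∣j∣)                                ≡⟨ fromℤ-◃ s (∣i∣ ℕ.* ∣j∣) ⟩
    signed s ((∣i∣ ℕ.* ∣j∣) ×ₙ 1#)                           ≡⟨ cong (signed s) (×1-homo-* ∣i∣ ∣j∣) ⟩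
    signed s (∣i∣ ×ₙ 1# * ∣j∣ ×ₙ 1#)                         ≡⟨ signed-* (ℤ.sign i) (ℤ.sign j) _ _ ⟩
    signed (ℤ.sign i) (∣i∣ ×ₙ 1#) * signed (ℤ.sign j) (∣j∣ ×ₙ 1#)
                                                             ≡⟨ sym (cong₂ _*_ (fromℤ-sign-abs i) (fromℤ-sign-abs j)) ⟩
    fromℤ i * fromℤ j                                        ∎
    where
      s = ℤ.sign i Sign.* ℤ.sign j
      ∣i∣ = ℤ.∣ i ∣
      ∣j∣ = ℤ.∣ j ∣

  private
    ℤ-rawRing : RawRing 0ℓ 0ℓ
    ℤ-rawRing = record
      { Carrier = ℤ ; _≈_ = _≡_ ; _+_ = ℤ._+_ ; _*_ = ℤ._*_ ; -_ = ℤ.-_ ; 0# = ℤ.+ 0 ; 1# = ℤ.+ 1 }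

    fromℤ-homomorphism : ℤ-rawRing -Raw-AlmostCommutative⟶ fromCommutativeRing commutativeRing
    fromℤ-homomorphism = record
      { ⟦_⟧ = fromℤ ; +-homo = fromℤ-+ ; *-homo = fromℤ-* ; -‿homo = fromℤ-neg
      ; 0-homo = refl ; 1-homo = +-identityʳ 1# }

    fromℤ-≟ : ∀ i j → Maybe (fromℤ i ≡ fromℤ j)
    fromℤ-≟ i j with i ℤ.≟ j
    ... | yes i≡j = just (cong fromℤ i≡j)
    ... | no _    = nothing

  open Algebra.Solver.Ring ℤ-rawRing (fromCommutativeRing commutativeRing) fromℤ-homomorphism fromℤ-≟
    using (solve; _:=_; _:+_; _:*_; :-_; _:-_; con)

  -- Finite sums

  open import Algebra.Properties.Semiring.Sum semiring
    using (sum; ∑-distrib-+; ∑-comm; sum-remove; sum-init-last; *-distribˡ-sum; sum-replicate-zero)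

  sumFin≡sum : ∀ {k} (f : Fin k → Carrier) → sumFin f ≡ sum f
  sumFin≡sum {zero}  f = refl
  sumFin≡sum {suc k} f = cong (f zero +_) (sumFin≡sum (f ∘ suc))

  sum-cong : ∀ {k} {f g : Fin k → Carrier} → (∀ i → f i ≡ g i) → sumFin f ≡ sumFin g
  sum-cong {zero}  f≗g = refl
  sum-cong {suc k} f≗g = cong₂ _+_ (f≗g zero) (sum-cong (f≗g ∘ suc))

  sum-zero : ∀ {k} {f : Fin k → Carrier} → (∀ i → f i ≡ 0#) → sumFin f ≡ 0#
  sum-zero {k} {f} f≗0 = begin
    sumFin f              ≡⟨ sum-cong f≗0 ⟩
    sumFin {k} (λ _ → 0#) ≡⟨ sumFin≡sum {k} (λ _ → 0#) ⟩
    sum {k} (λ _ → 0#)    ≡⟨ sum-replicate-zero k ⟩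
    0#                    ∎

  sum-*-zero : ∀ {k} (g : Fin k → Carrier) {f : Fin k → Carrier} → (∀ i → f i ≡ 0#) → sumFin (λ i → g i * f i) ≡ 0#
  sum-*-zero g f≗0 = sum-zero (λ i → trans (cong (g i *_) (f≗0 i)) (zeroʳ (g i)))

  sum-+ : ∀ {k} (f g : Fin k → Carrier) → sumFin (λ i → f i + g i) ≡ sumFin f + sumFin g
  sum-+ f g = begin
    sumFin (λ i → f i + g i)  ≡⟨ sumFin≡sum (λ i → f i + g i) ⟩
    sum (λ i → f i + g i)     ≡⟨ ∑-distrib-+ f g ⟩
    sum f + sum g             ≡⟨ sym (cong₂ _+_ (sumFin≡sum f) (sumFin≡sum g)) ⟩
    sumFin f + sumFin g       ∎

  sum-*ˡ : ∀ {k} c (f : Fin k → Carrier) → sumFin (λ i → c * f i) ≡ c * sumFin f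
  sum-*ˡ c f = begin
    sumFin (λ i → c * f i)  ≡⟨ sumFin≡sum (λ i → c * f i) ⟩
    sum (λ i → c * f i)     ≡⟨ sym (*-distribˡ-sum c f) ⟩
    c * sum f               ≡⟨ cong (c *_) (sym (sumFin≡sum f)) ⟩
    c * sumFin f            ∎

  sum-*ʳ : ∀ {k} c (f : Fin k → Carrier) → sumFin (λ i → f i * c) ≡ sumFin f * c
  sum-*ʳ c f = trans (sum-cong (λ i → *-comm (f i) c)) (trans (sum-*ˡ c f) (*-comm c _))

  sum-neg : ∀ {k} (f : Fin k → Carrier) → sumFin (λ i → - f i) ≡ - sumFin f
  sum-neg f = trans (sum-cong (λ i → sym (-1*x≡-x (f i)))) (trans (sum-*ˡ (- 1#) f) (-1*x≡-x _))
    where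
      -1*x≡-x : ∀ x → - 1# * x ≡ - x
      -1*x≡-x x = trans (sym (-‿distribˡ-* 1# x)) (cong -_ (*-identityˡ x))

  sum-swap : ∀ {k l} (f : Fin k → Fin l → Carrier) →
             sumFin (λ i → sumFin (f i)) ≡ sumFin (λ j → sumFin (λ i → f i j))
  sum-swap f = begin
    sumFin (λ i → sumFin (f i))           ≡⟨ nested (λ i j → f i j) ⟩
    sum (λ i → sum (f i))                 ≡⟨ ∑-comm f ⟩
    sum (λ j → sum (λ i → f i j))         ≡⟨ sym (nested (λ j i → f i j)) ⟩
    sumFin (λ j → sumFin (λ i → f i j))   ∎
    where
      nested : ∀ {k l} (g : Fin k → Fin l → Carrier) → sumFin (λ i → sumFin (g i)) ≡ sum (λ i → sum (g i))
      nested g = trans (sum-cong (sumFin≡sum ∘ g)) (sumFin≡sum (sum ∘ g))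

  sum-punchIn : ∀ {k} (i : Fin (suc k)) (f : Fin (suc k) → Carrier) →
                sumFin f ≡ f i + sumFin (f ∘ punchIn i)
  sum-punchIn i f = begin
    sumFin f                  ≡⟨ sumFin≡sum f ⟩
    sum f                     ≡⟨ sum-remove f ⟩
    f i + sum (f ∘ punchIn i) ≡⟨ cong (f i +_) (sym (sumFin≡sum (f ∘ punchIn i))) ⟩
    f i + sumFin (f ∘ punchIn i) ∎

  sum-single : ∀ {k} (i : Fin k) (f : Fin k → Carrier) → (∀ j → j ≢ i → f j ≡ 0#) → sumFin f ≡ f i
  sum-single {suc k} i f off-i = begin
    sumFin f                       ≡⟨ sum-punchIn i f ⟩
    f i + sumFin (f ∘ punchIn i)   ≡⟨ cong (f i +_) (sum-zero (λ j → off-i (punchIn i j) (Fin.punchInᵢ≢i i j))) ⟩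
    f i + 0#                       ≡⟨ +-identityʳ _ ⟩
    f i                            ∎

  sum-*-single : ∀ {k} (i : Fin k) (g : Fin k → Carrier) {f : Fin k → Carrier} → (∀ j → j ≢ i → f j ≡ 0#) →
                 sumFin (λ j → g j * f j) ≡ g i * f i
  sum-*-single i g off-i = sum-single i _ (λ j j≢i → trans (cong (g j *_) (off-i j j≢i)) (zeroʳ (g j)))

  sum-inject₁ : ∀ {k} (f : Fin (suc k) → Carrier) → sumFin f ≡ sumFin (f ∘ inject₁) + f (fromℕ k)
  sum-inject₁ f = begin
    sumFin f                              ≡⟨ sumFin≡sum f ⟩
    sum f                                 ≡⟨ sum-init-last f ⟩
    sum (f ∘ inject₁) + f (fromℕ _)       ≡⟨ cong (_+ f (fromℕ _)) (sym (sumFin≡sum (f ∘ inject₁))) ⟩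
    sumFin (f ∘ inject₁) + f (fromℕ _)    ∎

  -- Determinants

  altSign-+ : ∀ k x y → altSign k (x + y) ≡ altSign k x + altSign k y
  altSign-+ zero    x y = refl
  altSign-+ (suc k) x y = trans (cong -_ (altSign-+ k x y)) (sym (-‿+-comm _ _))

  altSign-*ˡ : ∀ k a x → altSign k (a * x) ≡ a * altSign k x
  altSign-*ˡ zero    a x = refl
  altSign-*ˡ (suc k) a x = trans (cong -_ (altSign-*ˡ k a x)) (-‿distribʳ-* a _)

  altSign-combination : ∀ k α β x y → altSign k (α * x + β * y) ≡ α * altSign k x + β * altSign k y
  altSign-combination k α β x y = trans (altSign-+ k _ _) (cong₂ _+_ (altSign-*ˡ k α x) (altSign-*ˡ k β y))

  altSign-0# : ∀ k → altSign k 0# ≡ 0#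
  altSign-0# zero    = refl
  altSign-0# (suc k) = trans (cong -_ (altSign-0# k)) -0#≈0#

  altSign-zeroˡ : ∀ k y → altSign k (0# * y) ≡ 0#
  altSign-zeroˡ k y = trans (cong (altSign k) (zeroˡ y)) (altSign-0# k)

  altSign-zeroʳ : ∀ k x → altSign k (x * 0#) ≡ 0#
  altSign-zeroʳ k x = trans (cong (altSign k) (zeroʳ x)) (altSign-0# k)

  altSign-neg : ∀ k x → altSign k (- x) ≡ - altSign k x
  altSign-neg zero    x = refl
  altSign-neg (suc k) x = cong -_ (altSign-neg k x)

  altSign-altSign : ∀ k l x → altSign k (altSign l x) ≡ altSign (k ℕ.+ l) x
  altSign-altSign zero    l x = refl
  altSign-altSign (suc k) l x = cong -_ (altSign-altSign k l x)

  altSign-involutive : ∀ k x → altSign k (altSign k x) ≡ x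
  altSign-involutive zero    x = refl
  altSign-involutive (suc k) x =
    trans (cong -_ (altSign-neg k _)) (trans (-‿involutive _) (altSign-involutive k x))

  altSign-sum : ∀ k {l} (f : Fin l → Carrier) → altSign k (sumFin f) ≡ sumFin (altSign k ∘ f)
  altSign-sum k {zero}  f = altSign-0# k
  altSign-sum k {suc l} f = trans (altSign-+ k _ _) (cong (altSign k (f zero) +_) (altSign-sum k (f ∘ suc)))

  altSign-injective-0# : ∀ k x → altSign k x ≡ 0# → x ≡ 0#
  altSign-injective-0# k x e =
    trans (sym (altSign-involutive k x)) (trans (cong (altSign k) e) (altSign-0# k))

  Matrix : ℕ → Set
  Matrix k = Fin k → Fin k → Carrier

  minor : ∀ {k} → Fin (suc k) → Matrix (suc k) → Matrix k
  minor j M a b = M (suc a) (punchIn j b)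

  laplaceTerm : ∀ {k} → Matrix (suc k) → Fin (suc k) → Carrier
  laplaceTerm {k} M j = altSign (toℕ' j) (M zero j * det k (minor j M))

  det-cong : ∀ k {M N : Matrix k} → (∀ a b → M a b ≡ N a b) → det k M ≡ det k N
  det-cong zero    M≗N = refl
  det-cong (suc k) M≗N = sum-cong λ j →
    cong (altSign (toℕ' j)) (cong₂ _*_ (M≗N zero j) (det-cong k (λ a b → M≗N (suc a) (punchIn j b))))

  private
    punchIn≢ : ∀ {k} {j c : Fin (suc k)} (j≢c : j ≢ c) {b : Fin k} → b ≢ punchOut j≢c → punchIn j b ≢ c
    punchIn≢ {j = j} j≢c b≢ e = b≢ (sym (trans (Fin.punchOut-cong j (sym e)) (Fin.punchOut-punchIn j)))

  det-linear-column : ∀ k (c : Fin k) (P Q S : Matrix k) α β →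
    (∀ a b → b ≢ c → P a b ≡ S a b) → (∀ a b → b ≢ c → Q a b ≡ S a b) →
    (∀ a → S a c ≡ α * P a c + β * Q a c) → det k S ≡ α * det k P + β * det k Q
  det-linear-column (suc k) c P Q S α β P≈S Q≈S Sc = begin
    sumFin (laplaceTerm S)
      ≡⟨ sum-cong term ⟩
    sumFin (λ j → α * laplaceTerm P j + β * laplaceTerm Q j)
      ≡⟨ sum-+ (λ j → α * laplaceTerm P j) (λ j → β * laplaceTerm Q j) ⟩
    sumFin (λ j → α * laplaceTerm P j) + sumFin (λ j → β * laplaceTerm Q j)
      ≡⟨ cong₂ _+_ (sum-*ˡ α (laplaceTerm P)) (sum-*ˡ β (laplaceTerm Q)) ⟩
    α * det (suc k) P + β * det (suc k) Q ∎
    where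
      term : ∀ j → laplaceTerm S j ≡ α * laplaceTerm P j + β * laplaceTerm Q j
      term j with j Fin.≟ c
      ... | yes refl = begin
        altSign n (S zero j * dS)                        ≡⟨ cong (λ x → altSign n (x * dS)) (Sc zero) ⟩
        altSign n ((α * p + β * q) * dS)                 ≡⟨ cong (altSign n) (solve 5 (λ a b p q d →
                                                               (a :* p :+ b :* q) :* d := a :* (p :* d) :+ b :* (q :* d))
                                                               refl α β p q dS) ⟩
        altSign n (α * (p * dS) + β * (q * dS))          ≡⟨ altSign-combination n α β _ _ ⟩
        α * altSign n (p * dS) + β * altSign n (q * dS)  ≡⟨ cong₂ (λ x y → α * altSign n (p * x) + β * altSign n (q * y))
                                                                 (sameMinor P P≈S) (sameMinor Q Q≈S) ⟩
        α * laplaceTerm P j + β * laplaceTerm Q j        ∎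
        where
          n = toℕ' j
          p = P zero j
          q = Q zero j
          dS = det k (minor j S)
          sameMinor : ∀ M → (∀ a b → b ≢ j → M a b ≡ S a b) → dS ≡ det k (minor j M)
          sameMinor M M≈S = det-cong k (λ a b → sym (M≈S (suc a) (punchIn j b) (Fin.punchInᵢ≢i j b)))
      ... | no j≢c = begin
        altSign n (S zero j * det k (minor j S))         ≡⟨ cong (λ x → altSign n (S zero j * x)) minors ⟩
        altSign n (S zero j * (α * dP + β * dQ))         ≡⟨ cong (altSign n) (solve 5 (λ a b s x y →
                                                               s :* (a :* x :+ b :* y) := a :* (s :* x) :+ b :* (s :* y))
                                                               refl α β (S zero j) dP dQ) ⟩
        altSign n (α * (S zero j * dP) + β * (S zero j * dQ))
                                                         ≡⟨ altSign-combination n α β _ _ ⟩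
        α * altSign n (S zero j * dP) + β * altSign n (S zero j * dQ)
                                                         ≡⟨ cong₂ (λ x y → α * altSign n (x * dP) + β * altSign n (y * dQ))
                                                                 (sym (P≈S zero j j≢c)) (sym (Q≈S zero j j≢c)) ⟩
        α * laplaceTerm P j + β * laplaceTerm Q j        ∎
        where
          n = toℕ' j
          dP = det k (minor j P)
          dQ = det k (minor j Q)
          c′ = punchOut j≢c
          c≡ : punchIn j c′ ≡ c
          c≡ = Fin.punchIn-punchOut j≢c
          minors : det k (minor j S) ≡ α * dP + β * dQ
          minors = det-linear-column k c′ (minor j P) (minor j Q) (minor j S) α β
            (λ a b b≢ → P≈S (suc a) (punchIn j b) (punchIn≢ j≢c b≢))
            (λ a b b≢ → Q≈S (suc a) (punchIn j b) (punchIn≢ j≢c b≢))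
            (λ a → trans (cong (S (suc a)) c≡)
                    (trans (Sc (suc a)) (cong₂ (λ x y → α * P (suc a) x + β * Q (suc a) y) (sym c≡) (sym c≡))))

  det-zero-column : ∀ k (c : Fin k) (M : Matrix k) → (∀ a → M a c ≡ 0#) → det k M ≡ 0#
  det-zero-column k c M Mc≡0 = begin
    det k M                       ≡⟨ det-linear-column k c M M M 0# 0# (λ _ _ _ → refl) (λ _ _ _ → refl)
                                                         (λ a → trans (Mc≡0 a) (sym 0·x+0·y)) ⟩
    0# * det k M + 0# * det k M   ≡⟨ 0·x+0·y ⟩
    0#                            ∎
    where
      0·x+0·y : ∀ {x y} → 0# * x + 0# * y ≡ 0#
      0·x+0·y = trans (cong₂ _+_ (zeroˡ _) (zeroˡ _)) (+-identityˡ 0#)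

  setColumn : ∀ {k} → Matrix k → Fin k → (Fin k → Carrier) → Matrix k
  setColumn M c v a b with b Fin.≟ c
  ... | yes _ = v a
  ... | no  _ = M a b

  setColumn-≡ : ∀ {k} (M : Matrix k) c v a → setColumn M c v a c ≡ v a
  setColumn-≡ M c v a with c Fin.≟ c
  ... | yes _   = refl
  ... | no  c≢c = ⊥-elim (c≢c refl)

  setColumn-≢ : ∀ {k} (M : Matrix k) c v a {b} → b ≢ c → setColumn M c v a b ≡ M a b
  setColumn-≢ M c v a {b} b≢c with b Fin.≟ c
  ... | yes b≡c = ⊥-elim (b≢c b≡c)
  ... | no  _   = refl

  setColumn-self : ∀ {k} (M : Matrix k) c a b → setColumn M c (λ a → M a c) a b ≡ M a b
  setColumn-self M c a b with b Fin.≟ c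
  ... | yes refl = refl
  ... | no  _    = refl

  setColumn-setColumn : ∀ {k} (M : Matrix k) c v w a b → setColumn (setColumn M c v) c w a b ≡ setColumn M c w a b
  setColumn-setColumn M c v w a b with b Fin.≟ c
  ... | yes _   = refl
  ... | no  b≢c = setColumn-≢ M c v a b≢c

  det-setColumn-sum : ∀ k {q} (c : Fin k) (S : Matrix k) (α : Fin q → Carrier) (u : Fin q → Fin k → Carrier) →
    (∀ a → S a c ≡ sumFin (λ l → α l * u l a)) → det k S ≡ sumFin (λ l → α l * det k (setColumn S c (u l)))
  det-setColumn-sum k {zero}  c S α u Sc = det-zero-column k c S Sc
  det-setColumn-sum k {suc q} c S α u Sc = begin
    det k S
      ≡⟨ det-linear-column k c (setColumn S c (u zero)) (setColumn S c rest) S (α zero) 1#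
           (λ a b → setColumn-≢ S c (u zero) a) (λ a b → setColumn-≢ S c rest a)
           (λ a → trans (Sc a) (cong₂ (λ x y → α zero * x + y) (sym (setColumn-≡ S c (u zero) a))
                                  (trans (sym (*-identityˡ _)) (cong (1# *_) (sym (setColumn-≡ S c rest a)))))) ⟩
    α zero * det k (setColumn S c (u zero)) + 1# * det k (setColumn S c rest)
      ≡⟨ cong (α zero * det k (setColumn S c (u zero)) +_) (trans (*-identityˡ _) restExpansion) ⟩
    sumFin (λ l → α l * det k (setColumn S c (u l))) ∎
    where
      rest : Fin k → Carrier
      rest a = sumFin (λ l → α (suc l) * u (suc l) a)
      restExpansion : det k (setColumn S c rest) ≡ sumFin (λ l → α (suc l) * det k (setColumn S c (u (suc l))))
      restExpansion =
        trans (det-setColumn-sum k c (setColumn S c rest) (α ∘ suc) (u ∘ suc) (setColumn-≡ S c rest))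
              (sum-cong (λ l → cong (α (suc l) *_) (det-cong k (setColumn-setColumn S c rest (u (suc l))))))

  det-equal-columns₀₁ : ∀ k (M : Matrix (suc (suc k))) → (∀ a → M a zero ≡ M a (suc zero)) →
                        det (suc (suc k)) M ≡ 0#
  det-equal-columns₀₁ k M M₀≡M₁ = begin
    laplaceTerm M zero + (laplaceTerm M (suc zero) + rest k M)
      ≡⟨ sym (+-assoc _ _ _) ⟩
    (laplaceTerm M zero + laplaceTerm M (suc zero)) + rest k M
      ≡⟨ cong₂ _+_ firstTwoCancel (restVanishes k M M₀≡M₁) ⟩
    0# + 0#
      ≡⟨ +-identityˡ 0# ⟩
    0# ∎
    where
      rest : ∀ k → Matrix (suc (suc k)) → Carrier
      rest k M = sumFin (λ j → laplaceTerm M (suc (suc j)))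
      minor₁≡minor₀ : ∀ a b → minor (suc zero) M a b ≡ minor zero M a b
      minor₁≡minor₀ a zero    = M₀≡M₁ (suc a)
      minor₁≡minor₀ a (suc b) = refl
      firstTwoCancel : laplaceTerm M zero + laplaceTerm M (suc zero) ≡ 0#
      firstTwoCancel = begin
        M zero zero * det (suc k) (minor zero M) + - (M zero (suc zero) * det (suc k) (minor (suc zero) M))
          ≡⟨ cong₂ (λ x y → M zero zero * det (suc k) (minor zero M) + - (x * y))
                   (sym (M₀≡M₁ zero)) (det-cong (suc k) minor₁≡minor₀) ⟩
        M zero zero * det (suc k) (minor zero M) + - (M zero zero * det (suc k) (minor zero M))
          ≡⟨ -‿inverseʳ _ ⟩
        0# ∎
      restVanishes : ∀ k (M : Matrix (suc (suc k))) → (∀ a → M a zero ≡ M a (suc zero)) → rest k M ≡ 0#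
      restVanishes zero    M M₀≡M₁ = refl
      restVanishes (suc k) M M₀≡M₁ = sum-zero λ j → begin
        altSign (toℕ' (suc (suc j))) (M zero (suc (suc j)) * det (suc (suc k)) (minor (suc (suc j)) M))
          ≡⟨ cong (λ x → altSign (toℕ' (suc (suc j))) (M zero (suc (suc j)) * x))
                  (det-equal-columns₀₁ k (minor (suc (suc j)) M) (M₀≡M₁ ∘ suc)) ⟩
        altSign (toℕ' (suc (suc j))) (M zero (suc (suc j)) * 0#)
          ≡⟨ altSign-zeroʳ (toℕ' (suc (suc j))) _ ⟩
        0# ∎

  moveColumnToFront : ∀ {k} → Fin (suc k) → Matrix (suc k) → Matrix (suc k)
  moveColumnToFront j M a zero    = M a j
  moveColumnToFront j M a (suc b) = M a (punchIn j b)

  private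
    punchIn-punchIn : ∀ {k} (j : Fin (suc (suc k))) (b : Fin (suc k)) (b≢ : punchIn j b ≢ j) (x : Fin k) →
                      punchIn j (punchIn b x) ≡ punchIn (punchIn j b) (punchIn (punchOut b≢) x)
    punchIn-punchIn {suc k} zero    b       b≢ x       = refl
    punchIn-punchIn         (suc j) zero    b≢ x       = refl
    punchIn-punchIn         (suc j) (suc b) b≢ zero    = refl
    punchIn-punchIn         (suc j) (suc b) b≢ (suc x) = cong suc (punchIn-punchIn j b (b≢ ∘ cong suc) x)

    punchIn-parity : ∀ {k} (j : Fin (suc (suc k))) (b : Fin (suc k)) (b≢ : punchIn j b ≢ j) →
                     toℕ' (punchIn j b) ℕ.+ toℕ' j ≡ suc (toℕ' b ℕ.+ toℕ' (punchOut b≢))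
    punchIn-parity {zero}  zero    zero    b≢ = refl
    punchIn-parity {suc k} zero    b       b≢ = refl
    punchIn-parity         (suc j) zero    b≢ = refl
    punchIn-parity {suc k} (suc j) (suc b) b≢ = begin
      suc (toℕ' (punchIn j b) ℕ.+ suc (toℕ' j))  ≡⟨ cong suc (ℕ.+-suc _ _) ⟩
      suc (suc (toℕ' (punchIn j b) ℕ.+ toℕ' j))  ≡⟨ cong (λ x → suc (suc x)) (punchIn-parity j b b≢′) ⟩
      suc (suc (suc (toℕ' b ℕ.+ toℕ' b′)))        ≡⟨ cong (λ x → suc (suc x)) (sym (ℕ.+-suc _ _)) ⟩
      suc (suc (toℕ' b ℕ.+ suc (toℕ' b′)))        ∎
      where
        b≢′ : punchIn j b ≢ j
        b≢′ = b≢ ∘ cong suc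
        b′ = punchOut b≢′

  det-moveColumnToFront : ∀ k (j : Fin (suc k)) (M : Matrix (suc k)) →
                          det (suc k) (moveColumnToFront j M) ≡ altSign (toℕ' j) (det (suc k) M)
  det-moveColumnToFront zero    zero M = refl
  det-moveColumnToFront (suc k) j    M = sym (begin
    altSign (toℕ' j) (sumFin (laplaceTerm M))
      ≡⟨ cong (altSign (toℕ' j)) (sum-punchIn j (laplaceTerm M)) ⟩
    altSign (toℕ' j) (laplaceTerm M j + sumFin (laplaceTerm M ∘ punchIn j))
      ≡⟨ altSign-+ (toℕ' j) _ _ ⟩
    altSign (toℕ' j) (laplaceTerm M j) + altSign (toℕ' j) (sumFin (laplaceTerm M ∘ punchIn j))
      ≡⟨ cong₂ _+_ (altSign-involutive (toℕ' j) _)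
                   (trans (altSign-sum (toℕ' j) (laplaceTerm M ∘ punchIn j)) (sum-cong term)) ⟩
    sumFin (laplaceTerm M′) ∎)
    where
      M′ = moveColumnToFront j M
      term : ∀ b → altSign (toℕ' j) (laplaceTerm M (punchIn j b)) ≡ laplaceTerm M′ (suc b)
      term b = begin
        altSign (toℕ' j) (altSign (toℕ' c) (M zero c * det (suc k) (minor c M)))
          ≡⟨ altSign-altSign (toℕ' j) (toℕ' c) _ ⟩
        altSign (toℕ' j ℕ.+ toℕ' c) (M zero c * det (suc k) (minor c M))
          ≡⟨ cong (λ n → altSign n (M zero c * det (suc k) (minor c M)))
                  (trans (ℕ.+-comm (toℕ' j) (toℕ' c)) (punchIn-parity j b c≢j)) ⟩
        - altSign (toℕ' b ℕ.+ toℕ' b′) (M zero c * det (suc k) (minor c M))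
          ≡⟨ cong -_ (sym (altSign-altSign (toℕ' b) (toℕ' b′) _)) ⟩
        - altSign (toℕ' b) (altSign (toℕ' b′) (M zero c * det (suc k) (minor c M)))
          ≡⟨ cong (λ x → - altSign (toℕ' b) x) (altSign-*ˡ (toℕ' b′) _ _) ⟩
        - altSign (toℕ' b) (M zero c * altSign (toℕ' b′) (det (suc k) (minor c M)))
          ≡⟨ cong (λ x → - altSign (toℕ' b) (M zero c * x))
                  (sym (trans (det-cong (suc k) minor≗) (det-moveColumnToFront k b′ (minor c M)))) ⟩
        laplaceTerm M′ (suc b) ∎
        where
          c = punchIn j b
          c≢j : c ≢ j
          c≢j = Fin.punchInᵢ≢i j b
          b′ = punchOut c≢j
          minor≗ : ∀ a x → minor (suc b) M′ a x ≡ moveColumnToFront b′ (minor c M) a x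
          minor≗ a zero    = cong (M (suc a)) (sym (Fin.punchIn-punchOut c≢j))
          minor≗ a (suc x) = cong (M (suc a)) (punchIn-punchIn j b c≢j x)

  det-equal-columns : ∀ k (M : Matrix k) {c c′ : Fin k} → c ≢ c′ → (∀ a → M a c ≡ M a c′) → det k M ≡ 0#
  det-equal-columns (suc zero)    M {zero} {zero} c≢c′ _ = ⊥-elim (c≢c′ refl)
  -- Move column c to the front, then column c′ (now at position suc c″); the first two columns coincide.
  det-equal-columns (suc (suc k)) M {c}    {c′}   c≢c′ Mc≡Mc′ =
    altSign-injective-0# (toℕ' c) _ (trans (sym (det-moveColumnToFront (suc k) c M))
      (altSign-injective-0# (toℕ' (suc c″)) _ (trans (sym (det-moveColumnToFront (suc k) (suc c″) M′))
        (det-equal-columns₀₁ k (moveColumnToFront (suc c″) M′)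
          (λ a → trans (cong (M a) (Fin.punchIn-punchOut c≢c′)) (sym (Mc≡Mc′ a)))))))
    where
      M′ = moveColumnToFront c M
      c″ = punchOut c≢c′

  det-setColumn-combination : ∀ k (M : Matrix k) (c : Fin k) (μ : Fin k → Carrier) →
    det k (setColumn M c (λ a → sumFin (λ b → μ b * M a b))) ≡ μ c * det k M
  det-setColumn-combination k M c μ = begin
    det k S                                                    ≡⟨ det-setColumn-sum k c S μ column (setColumn-≡ M c v) ⟩
    sumFin (λ b → μ b * det k (setColumn S c (column b)))      ≡⟨ sum-single c _ otherColumns ⟩
    μ c * det k (setColumn S c (column c))                     ≡⟨ cong (μ c *_) (det-cong k restored) ⟩
    μ c * det k M                                              ∎
    where
      v : Fin k → Carrier
      v a = sumFin (λ b → μ b * M a b)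
      S = setColumn M c v
      column : Fin k → Fin k → Carrier
      column b a = M a b
      restored : ∀ a b → setColumn S c (column c) a b ≡ M a b
      restored a b = trans (setColumn-setColumn M c v (column c) a b) (setColumn-self M c a b)
      otherColumns : ∀ b → b ≢ c → μ b * det k (setColumn S c (column b)) ≡ 0#
      otherColumns b b≢c = trans (cong (μ b *_) (det-equal-columns k _ b≢c λ a → begin
        setColumn S c (column b) a b  ≡⟨ setColumn-setColumn M c v (column b) a b ⟩
        setColumn M c (column b) a b  ≡⟨ setColumn-≢ M c (column b) a b≢c ⟩
        M a b                         ≡⟨ sym (setColumn-≡ S c (column b) a) ⟩
        setColumn S c (column b) a c  ∎)) (zeroʳ _)

  upperLeft : ∀ {k} → Matrix (suc k) → Matrix k
  upperLeft M a b = M (inject₁ a) (inject₁ b)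

  private
    punchIn-inject₁-fromℕ : ∀ {k} (j : Fin (suc k)) → punchIn (inject₁ j) (fromℕ k) ≡ fromℕ (suc k)
    punchIn-inject₁-fromℕ {zero}  zero    = refl
    punchIn-inject₁-fromℕ {suc k} zero    = refl
    punchIn-inject₁-fromℕ {suc k} (suc j) = cong suc (punchIn-inject₁-fromℕ j)

    punchIn-inject₁ : ∀ {k} (j : Fin (suc k)) (b : Fin k) → punchIn (inject₁ j) (inject₁ b) ≡ inject₁ (punchIn j b)
    punchIn-inject₁ zero    b       = refl
    punchIn-inject₁ (suc j) zero    = refl
    punchIn-inject₁ (suc j) (suc b) = cong suc (punchIn-inject₁ j b)

    toℕ'-inject₁ : ∀ {k} (j : Fin k) → toℕ' (inject₁ j) ≡ toℕ' j
    toℕ'-inject₁ zero    = refl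
    toℕ'-inject₁ (suc j) = cong suc (toℕ'-inject₁ j)

  det-lastColumn : ∀ k (M : Matrix (suc k)) → (∀ a → M (inject₁ a) (fromℕ k) ≡ 0#) →
                   det (suc k) M ≡ M (fromℕ k) (fromℕ k) * det k (upperLeft M)
  det-lastColumn zero    M _      = +-identityʳ _
  det-lastColumn (suc k) M last≡0 = begin
    sumFin (laplaceTerm M)
      ≡⟨ sum-inject₁ (laplaceTerm M) ⟩
    sumFin (laplaceTerm M ∘ inject₁) + laplaceTerm M (fromℕ (suc k))
      ≡⟨ cong₂ _+_ (sum-cong term) lastTerm ⟩
    sumFin (λ j → corner * laplaceTerm (upperLeft M) j) + 0#
      ≡⟨ trans (+-identityʳ _) (sum-*ˡ corner (laplaceTerm (upperLeft M))) ⟩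
    corner * det (suc k) (upperLeft M) ∎
    where
      corner = M (fromℕ (suc k)) (fromℕ (suc k))
      lastTerm : laplaceTerm M (fromℕ (suc k)) ≡ 0#
      lastTerm = trans (cong (λ x → altSign n (x * det (suc k) (minor (fromℕ (suc k)) M))) (last≡0 zero))
                       (altSign-zeroˡ n _)
        where n = toℕ' (fromℕ (suc k))
      term : ∀ j → laplaceTerm M (inject₁ j) ≡ corner * laplaceTerm (upperLeft M) j
      term j = begin
        altSign (toℕ' (inject₁ j)) (M zero (inject₁ j) * det (suc k) (minor (inject₁ j) M))
          ≡⟨ cong₂ (λ n x → altSign n (M zero (inject₁ j) * x)) (toℕ'-inject₁ j) minorExpansion ⟩
        altSign (toℕ' j) (M zero (inject₁ j) * (corner * det k (minor j (upperLeft M))))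
          ≡⟨ cong (altSign (toℕ' j)) (solve 3 (λ x c d → x :* (c :* d) := c :* (x :* d)) refl _ corner _) ⟩
        altSign (toℕ' j) (corner * (M zero (inject₁ j) * det k (minor j (upperLeft M))))
          ≡⟨ altSign-*ˡ (toℕ' j) corner _ ⟩
        corner * laplaceTerm (upperLeft M) j ∎
        where
          minorExpansion : det (suc k) (minor (inject₁ j) M) ≡ corner * det k (minor j (upperLeft M))
          minorExpansion = begin
            det (suc k) (minor (inject₁ j) M)
              ≡⟨ det-lastColumn k (minor (inject₁ j) M)
                   (λ a → trans (cong (M (suc (inject₁ a))) (punchIn-inject₁-fromℕ j)) (last≡0 (suc a))) ⟩
            minor (inject₁ j) M (fromℕ k) (fromℕ k) * det k (upperLeft (minor (inject₁ j) M))
              ≡⟨ cong₂ _*_ (cong (M (fromℕ (suc k))) (punchIn-inject₁-fromℕ j))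
                           (det-cong k (λ a b → cong (M (suc (inject₁ a))) (punchIn-inject₁ j b))) ⟩
            corner * det k (minor j (upperLeft M)) ∎

  -- Linear algebra over ℝ

  1≢0 : 1# ≢ 0#
  1≢0 1≡0 = 0≢1 (sym 1≡0)

  x*y≡0⇒y≡0 : ∀ {x y} → x ≢ 0# → x * y ≡ 0# → y ≡ 0#
  x*y≡0⇒y≡0 {x} {y} x≢0 xy≡0 with inverse x x≢0
  ... | x⁻¹ , xx⁻¹≡1 = begin
    y               ≡⟨ sym (*-identityˡ y) ⟩
    1# * y          ≡⟨ cong (_* y) (trans (sym xx⁻¹≡1) (*-comm x x⁻¹)) ⟩
    (x⁻¹ * x) * y   ≡⟨ *-assoc x⁻¹ x y ⟩
    x⁻¹ * (x * y)   ≡⟨ cong (x⁻¹ *_) xy≡0 ⟩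
    x⁻¹ * 0#        ≡⟨ zeroʳ x⁻¹ ⟩
    0#              ∎

  *-≢0 : ∀ {x y} → x ≢ 0# → y ≢ 0# → x * y ≢ 0#
  *-≢0 x≢0 y≢0 xy≡0 = y≢0 (x*y≡0⇒y≡0 x≢0 xy≡0)

  indicator : ∀ {k} → Fin k → Fin k → Carrier
  indicator c b with b Fin.≟ c
  ... | yes _ = 1#
  ... | no  _ = 0#

  indicator-≡ : ∀ {k} (c : Fin k) → indicator c c ≡ 1#
  indicator-≡ c with c Fin.≟ c
  ... | yes _   = refl
  ... | no  c≢c = ⊥-elim (c≢c refl)

  indicator-≢ : ∀ {k} {c b : Fin k} → b ≢ c → indicator c b ≡ 0#
  indicator-≢ {c = c} {b} b≢c with b Fin.≟ c
  ... | yes b≡c = ⊥-elim (b≢c b≡c)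
  ... | no  _   = refl

  sum-*-indicator : ∀ {k} (c : Fin k) (f : Fin k → Carrier) → sumFin (λ b → f b * indicator c b) ≡ f c
  sum-*-indicator c f = begin
    sumFin (λ b → f b * indicator c b) ≡⟨ sum-*-single c f (λ b → indicator-≢) ⟩
    f c * indicator c c                ≡⟨ trans (cong (f c *_) (indicator-≡ c)) (*-identityʳ _) ⟩
    f c                                ∎

  sum-insertAt : ∀ {q} (μ : Fin q → Carrier) i x (f : Fin (suc q) → Carrier) →
    sumFin (λ y → insertAt μ i x y * f y) ≡ x * f i + sumFin (λ j → μ j * f (punchIn i j))
  sum-insertAt μ i x f = trans (sum-punchIn i (λ y → insertAt μ i x y * f y))
    (cong₂ _+_ (cong (_* f i) (insertAt-lookup μ i x))
               (sum-cong (λ j → cong (_* f (punchIn i j)) (insertAt-punchIn μ i x j))))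

  sum-*-combination : ∀ {q k} (μ : Fin k → Carrier) (β : Fin q → Carrier) (U : Fin q → Fin k → Carrier) →
    sumFin (λ b → μ b * sumFin (λ i → β i * U i b)) ≡ sumFin (λ i → β i * sumFin (λ b → μ b * U i b))
  sum-*-combination μ β U = begin
    sumFin (λ b → μ b * sumFin (λ i → β i * U i b))
      ≡⟨ sum-cong (λ b → sym (sum-*ˡ (μ b) (λ i → β i * U i b))) ⟩
    sumFin (λ b → sumFin (λ i → μ b * (β i * U i b)))
      ≡⟨ sum-swap (λ b i → μ b * (β i * U i b)) ⟩
    sumFin (λ i → sumFin (λ b → μ b * (β i * U i b)))
      ≡⟨ sum-cong (λ i → trans (sum-cong (λ b → solve 3 (λ m b u → m :* (b :* u) := b :* (m :* u))
                                                         refl (μ b) (β i) (U i b)))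
                               (sum-*ˡ (β i) (λ b → μ b * U i b))) ⟩
    sumFin (λ i → β i * sumFin (λ b → μ b * U i b)) ∎

  sum-indicator-difference : ∀ {k} (i i′ : Fin k) (f : Fin k → Carrier) →
    sumFin (λ x → (indicator i x - indicator i′ x) * f x) ≡ f i - f i′
  sum-indicator-difference i i′ f = begin
    sumFin (λ x → (indicator i x - indicator i′ x) * f x)
      ≡⟨ sum-cong (λ x → solve 3 (λ a b y → (a :- b) :* y := y :* a :+ (:- (y :* b)))
                                 refl (indicator i x) (indicator i′ x) (f x)) ⟩
    sumFin (λ x → f x * indicator i x + - (f x * indicator i′ x))
      ≡⟨ sum-+ (λ x → f x * indicator i x) (λ x → - (f x * indicator i′ x)) ⟩
    sumFin (λ x → f x * indicator i x) + sumFin (λ x → - (f x * indicator i′ x))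
      ≡⟨ cong₂ _+_ (sum-*-indicator i f) (trans (sum-neg (λ x → f x * indicator i′ x)) (cong -_ (sum-*-indicator i′ f))) ⟩
    f i - f i′ ∎

  affinelyIndependent-injective : ∀ {k d} (p : Fin k → Fin d → Carrier) → AffinelyIndependent p →
                                  ∀ {i i′} → (∀ j → p i j ≡ p i′ j) → i ≡ i′
  affinelyIndependent-injective p p-indep {i} {i′} pᵢ≡pᵢ′ with i Fin.≟ i′
  ... | yes i≡i′ = i≡i′
  ... | no  i≢i′ = ⊥-elim (1≢0 (begin
    1#                                 ≡⟨ sym (trans (cong₂ _-_ (indicator-≡ i) (indicator-≢ i≢i′)) (x-0≡x 1#)) ⟩
    indicator i i - indicator i′ i     ≡⟨ p-indep l l-sum l-combination i ⟩
    0#                                 ∎))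
    where
      l : Fin _ → Carrier
      l x = indicator i x - indicator i′ x
      l-sum : sumFin l ≡ 0#
      l-sum = trans (sum-cong (λ x → sym (*-identityʳ (l x))))
                    (trans (sum-indicator-difference i i′ (λ _ → 1#)) (-‿inverseʳ 1#))
      l-combination : ∀ j → sumFin (λ x → l x * p x j) ≡ 0#
      l-combination j = trans (sum-indicator-difference i i′ (λ x → p x j))
                              (trans (cong (_- p i′ j) (pᵢ≡pᵢ′ j)) (-‿inverseʳ _))

  -- Equality in ℝ is undecidable, so the existence results of linear algebra below (dependences,
  -- coordinates) hold only in the double-negation monad; they are only ever used to derive ⊥.
  open RawMonad (¬¬-Monad {0ℓ}) using (pure; _>>=_)

  ¬¬-all-or-counterexample : ∀ k (P : Fin k → Set) → ¬ ¬ ((∀ i → P i) ⊎ ∃ λ i → ¬ P i)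
  ¬¬-all-or-counterexample zero    P = pure (inj₁ λ ())
  ¬¬-all-or-counterexample (suc k) P = do
    yes P₀ ← ¬¬-excluded-middle
      where no ¬P₀ → pure (inj₂ (zero , ¬P₀))
    inj₁ Pₛ ← ¬¬-all-or-counterexample k (P ∘ suc)
      where inj₂ (i , ¬Pᵢ) → pure (inj₂ (suc i , ¬Pᵢ))
    pure (inj₁ λ { zero → P₀ ; (suc i) → Pₛ i })

  LinearlyIndependent : ∀ {q k} → (Fin q → Fin k → Carrier) → Set
  LinearlyIndependent {q} u = ∀ (l : Fin q → Carrier) → (∀ c → sumFin (λ i → l i * u i c) ≡ 0#) → ∀ i → l i ≡ 0#

  IsLinearDependence : ∀ {q k} → (Fin q → Fin k → Carrier) → (Fin q → Carrier) → Set
  IsLinearDependence v l = (∃ λ j → l j ≢ 0#) × (∀ c → sumFin (λ j → l j * v j c) ≡ 0#)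

  dependence-with-zero-column : ∀ {q k} (v : Fin (suc q) → Fin (suc k) → Carrier) → (∀ j → v j zero ≡ 0#) →
    ∀ μ → IsLinearDependence (λ j c → v (suc j) (suc c)) μ → IsLinearDependence v (insertAt μ zero 0#)
  dependence-with-zero-column v v₀≡0 μ ((j , μj≢0) , dep) = (suc j , μj≢0) , combination
    where
      combination : ∀ c → sumFin (λ y → insertAt μ zero 0# y * v y c) ≡ 0#
      combination zero    = trans (cong₂ _+_ (zeroˡ _) (sum-*-zero μ (v₀≡0 ∘ suc)))
                                  (+-identityˡ 0#)
      combination (suc c) = trans (cong₂ _+_ (zeroˡ _) (dep c)) (+-identityˡ 0#)

  eliminateFirstCoordinate : ∀ {q k} (v : Fin (suc q) → Fin (suc k) → Carrier) → Fin (suc q) → Carrier →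
                             Fin q → Fin k → Carrier
  eliminateFirstCoordinate v i π j c = v (punchIn i j) (suc c) - ((v (punchIn i j) zero * π) * v i (suc c))

  liftByPivot : ∀ {q k} (v : Fin (suc q) → Fin (suc k) → Carrier) → Fin (suc q) → Carrier →
                (Fin q → Carrier) → Fin (suc q) → Carrier
  liftByPivot v i π μ = insertAt μ i (- sumFin (λ j → μ j * (v (punchIn i j) zero * π)))

  dependence-by-pivot : ∀ {q k} (v : Fin (suc q) → Fin (suc k) → Carrier) i π → v i zero * π ≡ 1# →
    ∀ μ → IsLinearDependence (eliminateFirstCoordinate v i π) μ → IsLinearDependence v (liftByPivot v i π μ)
  dependence-by-pivot v i π vᵢπ≡1 μ ((j , μj≢0) , dep) =
    (punchIn i j , λ e → μj≢0 (trans (sym (insertAt-punchIn μ i _ j)) e)) , combination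
    where
      w : Fin _ → Fin _ → Carrier
      w j = v (punchIn i j)
      t : Fin _ → Carrier
      t j = w j zero * π
      s = sumFin (λ j → μ j * t j)
      expand : ∀ c → sumFin (λ y → liftByPivot v i π μ y * v y c) ≡ - s * v i c + sumFin (λ j → μ j * w j c)
      expand c = sum-insertAt μ i (- s) (λ y → v y c)
      s·vᵢ₀ : s * v i zero ≡ sumFin (λ j → μ j * w j zero)
      s·vᵢ₀ = trans (sym (sum-*ʳ (v i zero) (λ j → μ j * t j))) (sum-cong λ j → begin
        μ j * (w j zero * π) * v i zero  ≡⟨ solve 4 (λ m b p x → m :* (b :* p) :* x := m :* b :* (x :* p))
                                                    refl (μ j) (w j zero) π (v i zero) ⟩
        μ j * w j zero * (v i zero * π)  ≡⟨ trans (cong (μ j * w j zero *_) vᵢπ≡1) (*-identityʳ _) ⟩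
        μ j * w j zero                   ∎)
      eliminated : ∀ c → sumFin (λ j → μ j * eliminateFirstCoordinate v i π j c) ≡
                         - s * v i (suc c) + sumFin (λ j → μ j * w j (suc c))
      eliminated c = begin
        sumFin (λ j → μ j * (w j (suc c) - (t j * x)))
          ≡⟨ sum-cong (λ j → solve 4 (λ m a b x → m :* (a :- b :* x) := m :* a :+ m :* b :* (:- x))
                                     refl (μ j) (w j (suc c)) (t j) x) ⟩
        sumFin (λ j → μ j * w j (suc c) + μ j * t j * - x)
          ≡⟨ sum-+ (λ j → μ j * w j (suc c)) (λ j → μ j * t j * - x) ⟩
        W + sumFin (λ j → μ j * t j * - x)
          ≡⟨ cong (W +_) (sum-*ʳ (- x) (λ j → μ j * t j)) ⟩
        W + s * - x
          ≡⟨ solve 3 (λ W s x → W :+ s :* (:- x) := (:- s) :* x :+ W) refl W s x ⟩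
        - s * x + W ∎
        where
          x = v i (suc c)
          W = sumFin (λ j → μ j * w j (suc c))
      combination : ∀ c → sumFin (λ y → liftByPivot v i π μ y * v y c) ≡ 0#
      combination zero = begin
        sumFin (λ y → liftByPivot v i π μ y * v y zero)  ≡⟨ expand zero ⟩
        - s * v i zero + sumFin (λ j → μ j * w j zero)   ≡⟨ cong (- s * v i zero +_) (sym s·vᵢ₀) ⟩
        - s * v i zero + s * v i zero                     ≡⟨ solve 2 (λ s y → (:- s) :* y :+ s :* y := con (ℤ.+ 0))
                                                                     refl s (v i zero) ⟩
        0#                                                ∎
      combination (suc c) = trans (expand (suc c)) (trans (sym (eliminated c)) (dep c))

  ¬¬-dependent : ∀ k (v : Fin (suc k) → Fin k → Carrier) → ¬ ¬ ∃ (IsLinearDependence v)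
  ¬¬-dependent zero    v = pure ((λ _ → 1#) , (zero , 1≢0) , λ ())
  ¬¬-dependent (suc k) v = do
    inj₂ (i , vᵢ₀≢0) ← ¬¬-all-or-counterexample (suc (suc k)) (λ j → v j zero ≡ 0#)
      where inj₁ v₀≡0 → do
              (μ , μ-dep) ← ¬¬-dependent k (λ j c → v (suc j) (suc c))
              pure (insertAt μ zero 0# , dependence-with-zero-column v v₀≡0 μ μ-dep)
    let (π , vᵢπ≡1) = inverse (v i zero) vᵢ₀≢0
    (μ , μ-dep) ← ¬¬-dependent k (eliminateFirstCoordinate v i π)
    pure (liftByPivot v i π μ , dependence-by-pivot v i π vᵢπ≡1 μ μ-dep)

  ¬¬-spans : ∀ k (u : Fin k → Fin k → Carrier) → LinearlyIndependent u →
             ∀ w → ¬ ¬ ∃ λ β → ∀ c → sumFin (λ i → β i * u i c) ≡ w c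
  ¬¬-spans k u u-indep w = do
    (l , (j , lⱼ≢0) , dep) ← ¬¬-dependent k (insertAt u zero w)
    no l₀≢0 ← ¬¬-excluded-middle
      where yes l₀≡0 → ⊥-elim (lⱼ≢0 (allZero l dep l₀≡0 j))
    let (r , l₀r≡1) = inverse (l zero) l₀≢0
    pure ((λ i → - (l (suc i) * r)) , solution l dep r l₀r≡1)
    where
      allZero : ∀ l → (∀ c → sumFin (λ j → l j * insertAt u zero w j c) ≡ 0#) → l zero ≡ 0# → ∀ j → l j ≡ 0#
      allZero l dep l₀≡0 zero    = l₀≡0
      allZero l dep l₀≡0 (suc i) = u-indep (l ∘ suc) (λ c → begin
        sumFin (λ i → l (suc i) * u i c)                  ≡⟨ sym (+-identityˡ _) ⟩
        0# + sumFin (λ i → l (suc i) * u i c)             ≡⟨ cong (_+ sumFin (λ i → l (suc i) * u i c))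
                                                                   (sym (trans (cong (_* w c) l₀≡0) (zeroˡ _))) ⟩
        l zero * w c + sumFin (λ i → l (suc i) * u i c)   ≡⟨ dep c ⟩
        0#                                                ∎) i
      solution : ∀ l → (∀ c → sumFin (λ j → l j * insertAt u zero w j c) ≡ 0#) → ∀ r → l zero * r ≡ 1# →
                 ∀ c → sumFin (λ i → - (l (suc i) * r) * u i c) ≡ w c
      solution l dep r l₀r≡1 c = begin
        sumFin (λ i → - (l (suc i) * r) * u i c)
          ≡⟨ sum-cong (λ i → solve 3 (λ a r x → (:- (a :* r)) :* x := (:- r) :* (a :* x)) refl (l (suc i)) r (u i c)) ⟩
        sumFin (λ i → - r * (l (suc i) * u i c))
          ≡⟨ sum-*ˡ (- r) (λ i → l (suc i) * u i c) ⟩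
        - r * S
          ≡⟨ solve 4 (λ r S a x → (:- r) :* S := r :* a :* x :+ (:- r) :* (a :* x :+ S)) refl r S (l zero) (w c) ⟩
        r * l zero * w c + - r * (l zero * w c + S)
          ≡⟨ cong₂ (λ x y → x * w c + - r * y) (trans (*-comm r _) l₀r≡1) (dep c) ⟩
        1# * w c + - r * 0#
          ≡⟨ trans (cong₂ _+_ (*-identityˡ _) (zeroʳ _)) (+-identityʳ _) ⟩
        w c ∎
        where
          S = sumFin (λ i → l (suc i) * u i c)

  det-kernelOfLowerRows : ∀ k (U : Matrix (suc k)) μ c → (∀ a → sumFin (λ j → μ j * U (suc a) j) ≡ 0#) →
    μ c * det (suc k) U ≡ altSign (toℕ' c) (sumFin (λ j → μ j * U zero j) * det k (minor c U))
  det-kernelOfLowerRows k U μ c lowerRows = begin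
    μ c * det (suc k) U           ≡⟨ sym (det-setColumn-combination (suc k) U c μ) ⟩
    det (suc k) S                 ≡⟨ sum-single c (laplaceTerm S) otherTermsVanish ⟩
    laplaceTerm S c               ≡⟨ cong₂ (λ x y → altSign (toℕ' c) (x * y))
                                           (setColumn-≡ U c Uμ zero) (det-cong k minor≗) ⟩
    altSign (toℕ' c) (Uμ zero * det k (minor c U)) ∎
    where
      Uμ : Fin (suc k) → Carrier
      Uμ a = sumFin (λ j → μ j * U a j)
      S = setColumn U c Uμ
      minor≗ : ∀ a b → minor c S a b ≡ minor c U a b
      minor≗ a b = setColumn-≢ U c Uμ (suc a) (Fin.punchInᵢ≢i c b)
      otherTermsVanish : ∀ j → j ≢ c → laplaceTerm S j ≡ 0#
      otherTermsVanish j j≢c = trans (cong (λ x → altSign (toℕ' j) (S zero j * x))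
        (det-zero-column k (punchOut j≢c) (minor j S) λ a →
          trans (cong (S (suc a)) (Fin.punchIn-punchOut j≢c)) (trans (setColumn-≡ U c Uμ (suc a)) (lowerRows a))))
        (altSign-zeroʳ (toℕ' j) _)

  independent⇒trivialKernel : ∀ k (U : Matrix k) → LinearlyIndependent U → ∀ μ c → μ c ≢ 0# →
                              ¬ (∀ i → sumFin (λ b → μ b * U i b) ≡ 0#)
  independent⇒trivialKernel k U U-indep μ c μc≢0 kernel = ¬¬-spans k U U-indep (indicator c) λ (β , β-spans) →
    μc≢0 (begin
      μ c                                                 ≡⟨ sym (sum-*-indicator c μ) ⟩
      sumFin (λ b → μ b * indicator c b)                  ≡⟨ sum-cong (λ b → cong (μ b *_) (sym (β-spans b))) ⟩
      sumFin (λ b → μ b * sumFin (λ i → β i * U i b))     ≡⟨ sum-*-combination μ β U ⟩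
      sumFin (λ i → β i * sumFin (λ b → μ b * U i b))     ≡⟨ sum-*-zero β kernel ⟩
      0#                                                  ∎)

  minor-independent : ∀ k (U : Matrix (suc k)) → LinearlyIndependent U → ∀ μ c → μ c ≢ 0# →
    (∀ a → sumFin (λ j → μ j * U (suc a) j) ≡ 0#) → LinearlyIndependent (minor c U)
  minor-independent k U U-indep μ c μc≢0 lowerRows l l-dep a =
    U-indep (insertAt l zero 0#) (λ b → trans (sum-insertAt l zero 0# (λ y → U y b))
                                              (trans (cong (_+ x b) (zeroˡ _)) (trans (+-identityˡ _) (x≡0 b))))
            (suc a)
    where
      x : Fin (suc k) → Carrier
      x b = sumFin (λ a → l a * U (suc a) b)
      x-offc : ∀ b → b ≢ c → x b ≡ 0#
      x-offc b b≢c = trans (cong x (sym (Fin.punchIn-punchOut (b≢c ∘ sym)))) (l-dep (punchOut (b≢c ∘ sym)))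
      xc≡0 : x c ≡ 0#
      xc≡0 = x*y≡0⇒y≡0 μc≢0 (begin
        μ c * x c                                               ≡⟨ sym (sum-*-single c μ x-offc) ⟩
        sumFin (λ b → μ b * x b)                                ≡⟨ sum-*-combination μ l (λ a b → U (suc a) b) ⟩
        sumFin (λ a → l a * sumFin (λ b → μ b * U (suc a) b))   ≡⟨ sum-*-zero l lowerRows ⟩
        0#                                                      ∎)
      x≡0 : ∀ b → x b ≡ 0#
      x≡0 b with b Fin.≟ c
      ... | yes refl = xc≡0
      ... | no  b≢c  = x-offc b b≢c

  det≢0 : ∀ k (U : Matrix k) → LinearlyIndependent U → det k U ≢ 0#
  det≢0 zero    U _       = 1≢0
  det≢0 (suc k) U U-indep detU≡0 = ¬¬-dependent k (λ j a → U (suc a) j) absurd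
    where
      absurd : ∃ (IsLinearDependence (λ j a → U (suc a) j)) → ⊥
      absurd (μ , (c , μc≢0) , lowerRows) = *-≢0 s≢0 (det≢0 k (minor c U) minor-indep) s·minor≡0
        where
          s = sumFin (λ j → μ j * U zero j)
          s≢0 : s ≢ 0#
          s≢0 s≡0 = independent⇒trivialKernel (suc k) U U-indep μ c μc≢0 λ { zero → s≡0 ; (suc a) → lowerRows a }
          minor-indep = minor-independent k U U-indep μ c μc≢0 lowerRows
          s·minor≡0 : s * det k (minor c U) ≡ 0#
          s·minor≡0 = altSign-injective-0# (toℕ' c) _
            (trans (sym (det-kernelOfLowerRows k U μ c lowerRows)) (trans (cong (μ c *_) detU≡0) (zeroʳ _)))

  -- Lifted point configurations

  snoc-inject₁ : ∀ n (f : Fin n → Carrier) c j → snoc n f c (inject₁ j) ≡ f j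
  snoc-inject₁ (suc n) f c zero    = refl
  snoc-inject₁ (suc n) f c (suc j) = snoc-inject₁ n (f ∘ suc) c j

  snoc-last : ∀ n (f : Fin n → Carrier) c → snoc n f c (fromℕ n) ≡ c
  snoc-last zero    f c = refl
  snoc-last (suc n) f c = snoc-last n (f ∘ suc) c

  snoc-≢last : ∀ n (f : Fin n → Carrier) c c′ {b} → b ≢ fromℕ n → snoc n f c b ≡ snoc n f c′ b
  snoc-≢last zero    f c c′ {zero}  b≢last = ⊥-elim (b≢last refl)
  snoc-≢last (suc n) f c c′ {zero}  b≢last = refl
  snoc-≢last (suc n) f c c′ {suc b} b≢last = snoc-≢last n (f ∘ suc) c c′ (b≢last ∘ cong suc)

  sum-snoc-* : ∀ n (f g : Fin n → Carrier) c d →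
    sumFin (λ i → snoc n f c i * snoc n g d i) ≡ sumFin (λ j → f j * g j) + c * d
  sum-snoc-* n f g c d = trans (sum-inject₁ (λ i → snoc n f c i * snoc n g d i))
    (cong₂ _+_ (sum-cong (λ j → cong₂ _*_ (snoc-inject₁ n f c j) (snoc-inject₁ n g d j)))
               (cong₂ _*_ (snoc-last n f c) (snoc-last n g d)))

  pointRow : ∀ {n} → (Fin n → Carrier) → Fin (suc n) → Carrier
  pointRow x zero    = 1#
  pointRow x (suc j) = x j

  pointMatrix : ∀ {n} → (Fin (suc n) → Fin n → Carrier) → Matrix (suc n)
  pointMatrix x i = pointRow (x i)

  pointMatrix-independent : ∀ {n} (x : Fin (suc n) → Fin n → Carrier) →
                            AffinelyIndependent x → LinearlyIndependent (pointMatrix x)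
  pointMatrix-independent x x-indep l l-dep =
    x-indep l (trans (sum-cong (λ i → sym (*-identityʳ (l i)))) (l-dep zero)) (l-dep ∘ suc)

  liftedRow-inject₁ : ∀ {n} (x : Fin n → Carrier) c b → liftedRow x c (inject₁ b) ≡ pointRow x b
  liftedRow-inject₁     x c zero    = refl
  liftedRow-inject₁ {n} x c (suc j) = snoc-inject₁ n x c j

  liftedRow-last : ∀ {n} (x : Fin n → Carrier) c → liftedRow x c (fromℕ (suc n)) ≡ c
  liftedRow-last {n} x c = snoc-last n x c

  liftedRow-≢last : ∀ {n} (x : Fin n → Carrier) c c′ {b} → b ≢ fromℕ (suc n) → liftedRow x c b ≡ liftedRow x c′ b
  liftedRow-≢last     x c c′ {zero}  b≢last = refl
  liftedRow-≢last {n} x c c′ {suc b} b≢last = snoc-≢last n x c c′ (b≢last ∘ cong suc)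

  liftedMatrix : ∀ {n} → (Fin (suc (suc n)) → Fin n → Carrier) → (Fin (suc (suc n)) → Carrier) → Matrix (suc (suc n))
  liftedMatrix x y i = liftedRow (x i) (y i)

  setColumn-liftedMatrix : ∀ {n} (x : Fin (suc (suc n)) → Fin n → Carrier) y z a b →
    setColumn (liftedMatrix x y) (fromℕ (suc n)) z a b ≡ liftedMatrix x z a b
  setColumn-liftedMatrix {n} x y z a b with b Fin.≟ fromℕ (suc n)
  ... | yes refl   = sym (liftedRow-last (x a) (z a))
  ... | no  b≢last = liftedRow-≢last (x a) (y a) (z a) b≢last

  det-liftedMatrix-combination : ∀ {n q} (x : Fin (suc (suc n)) → Fin n → Carrier)
    (β : Fin q → Carrier) (ys : Fin q → Fin (suc (suc n)) → Carrier) →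
    det (suc (suc n)) (liftedMatrix x (λ i → sumFin (λ j → β j * ys j i))) ≡
    sumFin (λ j → β j * det (suc (suc n)) (liftedMatrix x (ys j)))
  det-liftedMatrix-combination {n} x β ys =
    trans (det-setColumn-sum (suc (suc n)) (fromℕ (suc n)) (liftedMatrix x y) β ys (λ a → liftedRow-last (x a) (y a)))
          (sum-cong (λ j → cong (β j *_) (det-cong (suc (suc n)) (setColumn-liftedMatrix x y (ys j)))))
    where
      y = λ i → sumFin (λ j → β j * ys j i)

  det-liftedMatrix-interpolated : ∀ {n} (x : Fin (suc (suc n)) → Fin n → Carrier) y (φ : Carrier × (Fin n → Carrier)) →
    (∀ i → evalAff φ (x (inject₁ i)) ≡ y (inject₁ i)) →
    det (suc (suc n)) (liftedMatrix x y) ≡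
    (y (fromℕ (suc n)) - evalAff φ (x (fromℕ (suc n)))) * det (suc n) (pointMatrix (x ∘ inject₁))
  det-liftedMatrix-interpolated {n} x y (φ₀ , φ₁) φ-interpolates = begin
    det (suc (suc n)) (liftedMatrix x y)
      ≡⟨ det-cong (suc (suc n)) (λ a b → sym (trans (setColumn-liftedMatrix x e combination a b)
                                                    (cong (λ z → liftedRow (x a) z b) (α-combination a)))) ⟩
    det (suc (suc n)) (setColumn (liftedMatrix x e) last combination)
      ≡⟨ det-setColumn-combination (suc (suc n)) (liftedMatrix x e) last α ⟩
    α last * det (suc (suc n)) (liftedMatrix x e)
      ≡⟨ trans (cong (_* det (suc (suc n)) (liftedMatrix x e)) (snoc-last n φ₁ 1#)) (*-identityˡ _) ⟩
    det (suc (suc n)) (liftedMatrix x e)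
      ≡⟨ det-lastColumn (suc n) (liftedMatrix x e)
                        (λ a → trans (liftedRow-last (x (inject₁ a)) (e (inject₁ a))) (e-vanishes a)) ⟩
    liftedMatrix x e last last * det (suc n) (upperLeft (liftedMatrix x e))
      ≡⟨ cong₂ _*_ (liftedRow-last (x last) (e last))
                   (det-cong (suc n) (λ a b → liftedRow-inject₁ (x (inject₁ a)) (e (inject₁ a)) b)) ⟩
    e last * det (suc n) (pointMatrix (x ∘ inject₁)) ∎
    where
      last = fromℕ (suc n)
      e : Fin (suc (suc n)) → Carrier
      e i = y i - evalAff (φ₀ , φ₁) (x i)
      e-vanishes : ∀ a → e (inject₁ a) ≡ 0#
      e-vanishes a = trans (cong (λ z → y (inject₁ a) - z) (φ-interpolates a)) (-‿inverseʳ _)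
      α : Fin (suc (suc n)) → Carrier
      α zero    = φ₀
      α (suc i) = snoc n φ₁ 1# i
      combination : Fin (suc (suc n)) → Carrier
      combination a = sumFin (λ b → α b * liftedMatrix x e a b)
      α-combination : ∀ a → combination a ≡ y a
      α-combination a = begin
        φ₀ * 1# + sumFin (λ i → snoc n φ₁ 1# i * snoc n (x a) (e a) i)
          ≡⟨ cong (φ₀ * 1# +_) (sum-snoc-* n φ₁ (x a) 1# (e a)) ⟩
        φ₀ * 1# + (S + 1# * (y a - (φ₀ + S)))
          ≡⟨ cong₂ (λ u v → u + (S + v)) (*-identityʳ φ₀) (*-identityˡ _) ⟩
        φ₀ + (S + (y a - (φ₀ + S)))
          ≡⟨ solve 3 (λ p s z → p :+ (s :+ (z :- (p :+ s))) := z) refl φ₀ S (y a) ⟩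
        y a ∎
        where S = sumFin (λ j → φ₁ j * x a j)

  -- The sign of the edge length form

  open IsTotalOrder isTotalOrder using (total; antisym)

  x≤y⇒x-y≤0 : ∀ {x y} → x ≤ y → x - y ≤ 0#
  x≤y⇒x-y≤0 {x} {y} x≤y = subst (x - y ≤_) (-‿inverseʳ y) (+-mono-≤ (- y) x≤y)

  x≤0⇒0≤-x : ∀ {x} → x ≤ 0# → 0# ≤ - x
  x≤0⇒0≤-x {x} x≤0 = subst₂ _≤_ (-‿inverseʳ x) (+-identityˡ (- x)) (+-mono-≤ (- x) x≤0)

  0≤-x⇒x≤0 : ∀ {x} → 0# ≤ - x → x ≤ 0#
  0≤-x⇒x≤0 {x} 0≤-x = subst₂ _≤_ (+-identityˡ x) (-‿inverseˡ x) (+-mono-≤ x 0≤-x)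

  x≤0⇒0≤y⇒x*y≤0 : ∀ {x y} → x ≤ 0# → 0# ≤ y → x * y ≤ 0#
  x≤0⇒0≤y⇒x*y≤0 {x} {y} x≤0 0≤y =
    0≤-x⇒x≤0 (subst (0# ≤_) (sym (-‿distribˡ-* x y)) (*-nonneg (x≤0⇒0≤-x x≤0) 0≤y))

  x≤0⇒y≤0⇒0≤x*y : ∀ {x y} → x ≤ 0# → y ≤ 0# → 0# ≤ x * y
  x≤0⇒y≤0⇒0≤x*y {x} {y} x≤0 y≤0 =
    subst (0# ≤_) (solve 2 (λ x y → (:- x) :* (:- y) := x :* y) refl x y) (*-nonneg (x≤0⇒0≤-x x≤0) (x≤0⇒0≤-x y≤0))

  simplexDet : ∀ {m n} → (Fin m → Fin n → Carrier) → Simplex m n → Carrier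
  simplexDet {n = n} A w = det (suc n) (pointMatrix (λ i → A (w i)))

  simplexDet≢0 : ∀ {m n} (A : Fin m → Fin n → Carrier) (w : Simplex m n) → FullDimSimplex A w → simplexDet A w ≢ 0#
  simplexDet≢0 {n = n} A w w-indep =
    det≢0 (suc n) (pointMatrix (λ i → A (w i))) (pointMatrix-independent (λ i → A (w i)) w-indep)

  ℓ-on-H : ∀ {m n} (A : Fin m → Fin n → Carrier) (r : RidgeData m n) g → (g∈H : InH A (sOf r) g) →
    ℓ A r g ≡ (g (r (fromℕ (suc n))) - evalAff (proj₁ g∈H) (A (r (fromℕ (suc n))))) * simplexDet A (sOf r)
  ℓ-on-H A r g (φ , φ-interpolates , _) = det-liftedMatrix-interpolated (λ i → A (r i)) (λ i → g (r i)) φ φ-interpolates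

  InH-gap≤0 : ∀ {m n} (A : Fin m → Fin n → Carrier) (w : Simplex m n) g (g∈H : InH A w g) a →
              g a - evalAff (proj₁ g∈H) (A a) ≤ 0#
  InH-gap≤0 A w g (_ , _ , g≤φ) a = x≤y⇒x-y≤0 (g≤φ a)

  ℓ-signConstant-on-H : ∀ {m n} (A : Fin m → Fin n → Carrier) (r : RidgeData m n) →
    (∀ g → InH A (sOf r) g → ℓ A r g ≤ 0#) ⊎ (∀ g → InH A (sOf r) g → 0# ≤ ℓ A r g)
  ℓ-signConstant-on-H {n = n} A r with total 0# (simplexDet A (sOf r))
  ... | inj₁ 0≤D = inj₁ λ g g∈H →
    subst (_≤ 0#) (sym (ℓ-on-H A r g g∈H)) (x≤0⇒0≤y⇒x*y≤0 (InH-gap≤0 A (sOf r) g g∈H (r (fromℕ (suc n)))) 0≤D)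
  ... | inj₂ D≤0 = inj₂ λ g g∈H →
    subst (0# ≤_) (sym (ℓ-on-H A r g g∈H)) (x≤0⇒y≤0⇒0≤x*y (InH-gap≤0 A (sOf r) g g∈H (r (fromℕ (suc n)))) D≤0)

  ridge-vertex≢apex : ∀ {m n} (A : Fin m → Fin n → Carrier) (r : RidgeData m n) → IsRidge A r →
                      ∀ i → r (inject₁ i) ≢ r (fromℕ (suc n))
  ridge-vertex≢apex A r (_ , _      , r₀≢apex) zero    = r₀≢apex
  ridge-vertex≢apex A r (_ , t-indep , _)      (suc i) rᵢ≡apex = Fin.fromℕ≢inject₁
    (sym (affinelyIndependent-injective (λ i → A (tOf r i)) t-indep (λ j → cong (λ v → A v j) rᵢ≡apex)))

  ℓ-apexIndicator : ∀ {m n} (A : Fin m → Fin n → Carrier) (r : RidgeData m n) → IsRidge A r →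
                    ℓ A r (indicator (r (fromℕ (suc n)))) ≡ simplexDet A (sOf r)
  ℓ-apexIndicator {n = n} A r ridge = begin
    ℓ A r (indicator apex)
      ≡⟨ det-liftedMatrix-interpolated (λ i → A (r i)) (λ i → indicator apex (r i)) zeroMap interpolates ⟩
    (indicator apex apex - evalAff zeroMap (A apex)) * D
      ≡⟨ cong₂ (λ x y → (x - y) * D) (indicator-≡ apex) (evalAff-zero (A apex)) ⟩
    (1# - 0#) * D
      ≡⟨ trans (cong (_* D) (x-0≡x 1#)) (*-identityˡ D) ⟩
    D ∎
    where
      apex = r (fromℕ (suc n))
      D = simplexDet A (sOf r)
      zeroMap : Carrier × (Fin n → Carrier)
      zeroMap = 0# , λ _ → 0#
      evalAff-zero : ∀ x → evalAff zeroMap x ≡ 0#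
      evalAff-zero x = trans (+-identityˡ _) (sum-zero (λ j → zeroˡ (x j)))
      interpolates : ∀ i → evalAff zeroMap (A (r (inject₁ i))) ≡ indicator apex (r (inject₁ i))
      interpolates i = trans (evalAff-zero _) (sym (indicator-≢ (ridge-vertex≢apex A r ridge i)))

  ℓ-zeroSet-notFullDim : ∀ {m n} (A : Fin m → Fin n → Carrier) (r : RidgeData m n) → IsRidge A r →
                         ¬ HasFullDim (λ g → ℓ A r g ≡ 0#)
  ℓ-zeroSet-notFullDim {m} {n} A r ridge (p , ℓp≡0 , p-indep) =
    ¬¬-spans (suc m) (pointMatrix p) (pointMatrix-independent p p-indep) (pointRow (indicator apex)) λ (β , β-spans) →
    simplexDet≢0 A (sOf r) (proj₁ ridge) (begin
      simplexDet A (sOf r)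
        ≡⟨ sym (ℓ-apexIndicator A r ridge) ⟩
      ℓ A r (indicator apex)
        ≡⟨ det-cong (suc (suc n)) (λ a b → cong (λ z → liftedRow (A (r a)) z b) (sym (β-spans (suc (r a))))) ⟩
      det (suc (suc n)) (liftedMatrix (λ i → A (r i)) (λ i → sumFin (λ j → β j * p j (r i))))
        ≡⟨ det-liftedMatrix-combination (λ i → A (r i)) β (λ j i → p j (r i)) ⟩
      sumFin (λ j → β j * ℓ A r (p j))
        ≡⟨ sum-*-zero β ℓp≡0 ⟩
      0# ∎)
    where
      apex = r (fromℕ (suc n))

  ℓ-oppositeSigns-notFullDim : ∀ {m n} (A : Fin m → Fin n → Carrier) (r : RidgeData m n) → IsRidge A r →
    HasFullDim (λ g → 0# ≤ ℓ A r g × InH A (sOf r) g) → ¬ HasFullDim (λ g → 0# ≤ - ℓ A r g × InH A (sOf r) g)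
  ℓ-oppositeSigns-notFullDim A r ridge (p , p∈ , p-indep) (q , q∈ , q-indep) with ℓ-signConstant-on-H A r
  ... | inj₁ ℓ≤0 = ℓ-zeroSet-notFullDim A r ridge
    (p , (λ i → let (0≤ℓ , p∈H) = p∈ i in antisym (ℓ≤0 (p i) p∈H) 0≤ℓ) , p-indep)
  ... | inj₂ 0≤ℓ = ℓ-zeroSet-notFullDim A r ridge
    (q , (λ i → let (0≤-ℓ , q∈H) = q∈ i in antisym (0≤-x⇒x≤0 0≤-ℓ) (0≤ℓ (q i) q∈H)) , q-indep)

  ridge-sign-determined : ∀ {m n} (A : Fin m → Fin n → Carrier) (r : RidgeData m n) → IsRidge A r → ∀ σ τ →
    HasFullDim (λ g → 0# ≤ applySign σ (ℓ A r g) × InH A (sOf r) g) →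
    HasFullDim (λ g → 0# ≤ applySign τ (ℓ A r g) × InH A (sOf r) g) → σ ≡ τ
  ridge-sign-determined A r ridge plus  plus  _     _     = refl
  ridge-sign-determined A r ridge minus minus _     _     = refl
  ridge-sign-determined A r ridge plus  minus full₊ full₋ = ⊥-elim (ℓ-oppositeSigns-notFullDim A r ridge full₊ full₋)
  ridge-sign-determined A r ridge minus plus  full₋ full₊ = ⊥-elim (ℓ-oppositeSigns-notFullDim A r ridge full₊ full₋)

open import Defs
open import Data.List using (List)
open import Data.List.Membership.Propositional using (_∈_)
open import Data.List.Relation.Unary.All using (lookup)
open import Function.Definitions using (Injective)

proposition3p10 : (ℝ : RealField) (n m : ℕ) (A : Fin m → Fin n → RealField.Carrier ℝ) →
    Injective _≡_ _≡_ A → AffinelySpanning ℝ A →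
    (R : List (RidgeData ℝ m n)) → IsRidgeGraph ℝ A R →
    (r₁ r₂ : RidgeData ℝ m n) → r₁ ∈ R → r₂ ∈ R →
    (σ₁ σ₂ τ₁ τ₂ : Sign ℝ) →
    HasFullDim ℝ (λ g → InCone ℝ A r₁ r₂ σ₁ σ₂ g × InSc ℝ A R g) →
    HasFullDim ℝ (λ g → InCone ℝ A r₁ r₂ τ₁ τ₂ g × InSc ℝ A R g) →
    (σ₁ ≡ τ₁) × (σ₂ ≡ τ₂)
proposition3p10 ℝ n m A _ _ R (ridges , _) r₁ r₂ r₁∈R r₂∈R σ₁ σ₂ τ₁ τ₂ full-σ full-τ =
  ridge-sign-determined ℝ A r₁ (lookup ridges r₁∈R) σ₁ τ₁ (first σ₁ σ₂ full-σ) (first τ₁ τ₂ full-τ) ,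
  ridge-sign-determined ℝ A r₂ (lookup ridges r₂∈R) σ₂ τ₂ (second σ₁ σ₂ full-σ) (second τ₁ τ₂ full-τ)
  where
    open RealField ℝ using (_≤_; 0#)
    first : ∀ ρ₁ ρ₂ → HasFullDim ℝ (λ g → InCone ℝ A r₁ r₂ ρ₁ ρ₂ g × InSc ℝ A R g) →
            HasFullDim ℝ (λ g → 0# ≤ applySign ℝ ρ₁ (ℓ ℝ A r₁ g) × InH ℝ A (sOf ℝ r₁) g)
    first _ _ (p , p∈ , p-indep) =
      p , (λ i → let (cone , p∈sc) = p∈ i in proj₁ cone , proj₁ (lookup p∈sc r₁∈R)) , p-indep
    second : ∀ ρ₁ ρ₂ → HasFullDim ℝ (λ g → InCone ℝ A r₁ r₂ ρ₁ ρ₂ g × InSc ℝ A R g) →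
             HasFullDim ℝ (λ g → 0# ≤ applySign ℝ ρ₂ (ℓ ℝ A r₂ g) × InH ℝ A (sOf ℝ r₂) g)
    second _ _ (p , p∈ , p-indep) =
      p , (λ i → let (cone , p∈sc) = p∈ i in proj₁ (proj₂ cone) , proj₁ (lookup p∈sc r₂∈R)) , p-indep
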